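{- Let $H$ be an atomic monoid. Then \[\mathcal A(M_H)\subset\{(uH^\times,uH^\times): u\in\mathcal A(H)\}\cup\{(x,y)\in M_H:\gcd(x,y)=1\}.\]
   Context: A monoid is a commutative, cancellative semigroup with identity; $H_{\mathrm{red}}=H/H^\times$; atomic means every non-unit is a product of atoms. $\mathsf Z(H)$ is the free abelian monoid on $\mathcal A(H_{\mathrm{red}})$ and $\pi_H:\mathsf Z(H)\to H_{\mathrm{red}}$ the homomorphism restricting to the identity on atoms; gcd is taken in the free monoid $\mathsf Z(H)$. $M_H=\{(x,y)\in\mathsf Z(H)\times\mathsf Z(H):\pi_H(x)=\pi_H(y)\}$ is the monoid of relations (a submonoid of $\mathsf Z(H)\times\mathsf Z(H)$), and $\mathcal A(M_H)$ its set of atoms. -}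

module Defs where

open import Level using (Level; _⊔_)
open import Algebra.Bundles using (CommutativeMonoid)
open import Data.Product using (Σ; ∃; ∃-syntax; _×_; _,_; proj₁)
open import Data.Sum using (_⊎_)
open import Data.List using (List; []; _∷_; [_]; _++_; foldr; map)
open import Relation.Nullary using (¬_)
import Data.List.Relation.Binary.Permutation.Homogeneous as Homogeneous

-- H_red = H / H^× is represented by working in H up to the
-- associate relation  a ∼ b  (∃ unit u, a ≈ b ∙ u).
module MonoidTheory {c ℓ : Level} (H : CommutativeMonoid c ℓ) where
  open CommutativeMonoid H

  Cancellative : Set (c ⊔ ℓ)
  Cancellative = ∀ a b d → a ∙ b ≈ a ∙ d → b ≈ d

  IsUnit : Carrier → Set (c ⊔ ℓ)
  IsUnit a = ∃[ b ] (a ∙ b ≈ ε)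

  -- associated elements: equality in H_red
  _∼_ : Carrier → Carrier → Set (c ⊔ ℓ)
  a ∼ b = ∃[ u ] (IsUnit u × a ≈ b ∙ u)

  IsAtom : Carrier → Set (c ⊔ ℓ)
  IsAtom a = ¬ IsUnit a × (∀ b d → a ≈ b ∙ d → IsUnit b ⊎ IsUnit d)

  Atom : Set (c ⊔ ℓ)
  Atom = Σ Carrier IsAtom

  prod : List Carrier → Carrier
  prod = foldr _∙_ ε

  Atomic : Set (c ⊔ ℓ)
  Atomic = ∀ a → ¬ IsUnit a →
           Σ (List Atom) (λ as → prod (map proj₁ as) ≈ a)

  -- atoms of H_red = atoms of H up to associates
  _∼ₐ_ : Atom → Atom → Set (c ⊔ ℓ)
  a ∼ₐ b = proj₁ a ∼ proj₁ b

  -- Z(H): free abelian monoid on A(H_red), realised as lists of atoms of H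
  -- modulo permutation and associates; the monoid operation is _++_, the
  -- identity is [].
  Z : Set (c ⊔ ℓ)
  Z = List Atom

  _≋_ : Z → Z → Set (c ⊔ ℓ)
  _≋_ = Homogeneous.Permutation _∼ₐ_

  -- π_H : Z(H) → H_red (value in H, read up to ∼)
  π : Z → Carrier
  π = foldr (λ a r → proj₁ a ∙ r) ε

  InM : Z → Z → Set (c ⊔ ℓ)
  InM x y = π x ∼ π y

  IsUnitM : Z → Z → Set (c ⊔ ℓ)
  IsUnitM x y = ∃[ x' ] ∃[ y' ] (InM x' y' × (x ++ x') ≋ [] × (y ++ y') ≋ [])

  IsAtomM : Z → Z → Set (c ⊔ ℓ)
  IsAtomM x y =
    InM x y × ¬ IsUnitM x y ×
    (∀ x₁ y₁ x₂ y₂ → InM x₁ y₁ → InM x₂ y₂ →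
       x ≋ (x₁ ++ x₂) → y ≋ (y₁ ++ y₂) → IsUnitM x₁ y₁ ⊎ IsUnitM x₂ y₂)

  _∣Z_ : Z → Z → Set (c ⊔ ℓ)
  d ∣Z x = ∃[ z ] (x ≋ (d ++ z))

  GcdOne : Z → Z → Set (c ⊔ ℓ)
  GcdOne x y = ∀ d → d ∣Z x → d ∣Z y → d ≋ []

module Submission where

-- Suppose an atom (x, y) of M_H has a non-trivial common divisor in
-- Z(H); then it has a common atom u.  Writing x = u·x' and y = u·y',
-- cancellativity of H gives π(x') ∼ π(y'), so (x, y) = (u, u)·(x', y') is a
-- factorization in M_H.  The factor (u, u) is not a unit (units of M_H are
-- empty factorizations), hence (x', y') is a unit, i.e. x' = y' = 1 and
-- x ≋ y ≋ u.  So unless x and y are both single atoms, gcd(x, y) = 1; and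
-- if they are single atoms a, b then π-equality says a ∼ b.

open import Defs
open import Level using (Level; _⊔_)
open import Algebra.Bundles using (CommutativeMonoid)
open import Algebra.Structures using (IsCommutativeMonoid)
open import Data.Product using (∃-syntax; _×_; _,_; proj₁)
open import Data.Sum using (_⊎_; inj₁; inj₂)
import Data.Sum as Sum
open import Data.List using (List; []; _∷_; [_]; _++_; length; foldr; map)
open import Data.List.Properties using (foldr-map)
open import Data.Empty using (⊥-elim)
open import Relation.Nullary using (¬_)
open import Relation.Binary.Bundles using (Setoid)
open import Relation.Binary.Structures using (IsEquivalence)
open import Relation.Binary.PropositionalEquality as P using (_≡_)
import Relation.Binary.Construct.On as On
import Relation.Binary.Reasoning.Setoid as SetoidReasoning
import Algebra.Properties.CommutativeSemigroup as CommSemigroupProperties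
import Data.List.Relation.Binary.Permutation.Setoid as Permutation
import Data.List.Relation.Binary.Permutation.Setoid.Properties as PermProperties

singletons-or-not : ∀ {a} {A : Set a} (xs ys : List A) →
  (∃[ p ] ∃[ q ] (xs ≡ [ p ] × ys ≡ [ q ])) ⊎ ¬ (length xs ≡ 1 × length ys ≡ 1)
singletons-or-not (p ∷ []) (q ∷ [])     = inj₁ (p , q , P.refl , P.refl)
singletons-or-not []       _            = inj₂ λ ()
singletons-or-not (_ ∷ _ ∷ _) _         = inj₂ λ ()
singletons-or-not (_ ∷ []) []           = inj₂ λ ()
singletons-or-not (_ ∷ []) (_ ∷ _ ∷ _)  = inj₂ λ ()

module Associates {c ℓ : Level} (H : CommutativeMonoid c ℓ) where
  open CommutativeMonoid H
  open MonoidTheory H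
  open CommSemigroupProperties commutativeSemigroup using (interchange)
  open SetoidReasoning setoid

  ε-unit : IsUnit ε
  ε-unit = ε , identityˡ ε

  ∙-unit : ∀ {u v} → IsUnit u → IsUnit v → IsUnit (u ∙ v)
  ∙-unit {u} {v} (u⁻¹ , uu⁻¹) (v⁻¹ , vv⁻¹) = u⁻¹ ∙ v⁻¹ , (begin
    (u ∙ v) ∙ (u⁻¹ ∙ v⁻¹) ≈⟨ interchange u v u⁻¹ v⁻¹ ⟩
    (u ∙ u⁻¹) ∙ (v ∙ v⁻¹) ≈⟨ ∙-cong uu⁻¹ vv⁻¹ ⟩
    ε ∙ ε                 ≈⟨ identityˡ ε ⟩
    ε                     ∎)

  ≈⇒∼ : ∀ {a b} → a ≈ b → a ∼ b
  ≈⇒∼ {b = b} a≈b = ε , ε-unit , trans a≈b (sym (identityʳ b))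

  ∼-isEquivalence : IsEquivalence _∼_
  ∼-isEquivalence = record { refl = ≈⇒∼ refl ; sym = ∼-sym ; trans = ∼-trans }
    where
    ∼-sym : ∀ {a b} → a ∼ b → b ∼ a
    ∼-sym {a} {b} (u , (u⁻¹ , uu⁻¹) , a≈bu) = u⁻¹ , (u , trans (comm u⁻¹ u) uu⁻¹) , (begin
      b               ≈⟨ sym (identityʳ b) ⟩
      b ∙ ε           ≈⟨ ∙-congˡ (sym uu⁻¹) ⟩
      b ∙ (u ∙ u⁻¹)   ≈⟨ sym (assoc b u u⁻¹) ⟩
      (b ∙ u) ∙ u⁻¹   ≈⟨ ∙-congʳ (sym a≈bu) ⟩
      a ∙ u⁻¹         ∎)
    ∼-trans : ∀ {a b d} → a ∼ b → b ∼ d → a ∼ d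
    ∼-trans {a} {b} {d} (u , u-unit , a≈bu) (v , v-unit , b≈dv) = v ∙ u , ∙-unit v-unit u-unit , (begin
      a             ≈⟨ a≈bu ⟩
      b ∙ u         ≈⟨ ∙-congʳ b≈dv ⟩
      (d ∙ v) ∙ u   ≈⟨ assoc d v u ⟩
      d ∙ (v ∙ u)   ∎)

  ∙-cong-∼ : ∀ {a a' b b'} → a ∼ a' → b ∼ b' → (a ∙ b) ∼ (a' ∙ b')
  ∙-cong-∼ {a} {a'} {b} {b'} (u , u-unit , a≈a'u) (v , v-unit , b≈b'v) =
    u ∙ v , ∙-unit u-unit v-unit , (begin
      a ∙ b                 ≈⟨ ∙-cong a≈a'u b≈b'v ⟩
      (a' ∙ u) ∙ (b' ∙ v)   ≈⟨ interchange a' u b' v ⟩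
      (a' ∙ b') ∙ (u ∙ v)   ∎)

  ∼-isCommutativeMonoid : IsCommutativeMonoid _∼_ _∙_ ε
  ∼-isCommutativeMonoid = record
    { isMonoid = record
      { isSemigroup = record
        { isMagma = record { isEquivalence = ∼-isEquivalence ; ∙-cong = ∙-cong-∼ }
        ; assoc = λ a b d → ≈⇒∼ (assoc a b d)
        }
      ; identity = (λ a → ≈⇒∼ (identityˡ a)) , (λ a → ≈⇒∼ (identityʳ a))
      }
    ; comm = λ a b → ≈⇒∼ (comm a b)
    }

  Hred : CommutativeMonoid c (c ⊔ ℓ)
  Hred = record { isCommutativeMonoid = ∼-isCommutativeMonoid }

  -- Atoms up to associates: the generators of Z(H).  By construction the
  -- relation _≋_ on Z(H) is the permutation relation of this setoid.
  atomSetoid : Setoid (c ⊔ ℓ) (c ⊔ ℓ)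
  atomSetoid = On.setoid {B = Atom} (CommutativeMonoid.setoid Hred) proj₁

  -- π is well defined on Z(H): it is the H_red-product of the underlying
  -- elements, and products in a commutative monoid are permutation invariant.
  π-resp-≋ : ∀ {xs ys} → xs ≋ ys → π xs ∼ π ys
  π-resp-≋ {xs} {ys} xs≋ys =
    P.subst₂ _∼_ (foldr-map _∙_ proj₁ ε xs) (foldr-map _∙_ proj₁ ε ys) products-∼
    where
    open PermProperties (CommutativeMonoid.setoid Hred) using (foldr-commMonoid)
    open PermProperties atomSetoid using (map⁺)
    products-∼ : foldr _∙_ ε (map proj₁ xs) ∼ foldr _∙_ ε (map proj₁ ys)
    products-∼ = foldr-commMonoid ∼-isCommutativeMonoid
      (map⁺ (CommutativeMonoid.setoid Hred) (λ a∼b → a∼b) xs≋ys)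

  cancel-∼ : Cancellative → ∀ u a b → (u ∙ a) ∼ (u ∙ b) → a ∼ b
  cancel-∼ cancel u a b (w , w-unit , ua≈ubw) =
    w , w-unit , cancel u a (b ∙ w) (trans ua≈ubw (assoc u b w))

module Relations {c ℓ : Level} (H : CommutativeMonoid c ℓ)
                 (cancel : MonoidTheory.Cancellative H) where
  open CommutativeMonoid H using (sym; identityʳ)
  open MonoidTheory H
  open Associates H
  open IsEquivalence ∼-isEquivalence using () renaming (refl to ∼-refl; sym to ∼-sym; trans to ∼-trans)
  open PermProperties atomSetoid using (¬x∷xs↭[]; xs↭ys⇒|xs|≡|ys|)
  open Permutation atomSetoid using (prep; ↭-refl)

  ++-≋-[] : ∀ (x x' : Z) → (x ++ x') ≋ [] → x ≡ []
  ++-≋-[] []      _ _ = P.refl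
  ++-≋-[] (_ ∷ _) _ p = ⊥-elim (¬x∷xs↭[] p)

  unitM-trivial : ∀ {x y} → IsUnitM x y → x ≡ [] × y ≡ []
  unitM-trivial {x} {y} (x' , y' , _ , xx'≋[] , yy'≋[]) =
    ++-≋-[] x x' xx'≋[] , ++-≋-[] y y' yy'≋[]

  singleton-relation : ∀ {a b} → InM [ a ] [ b ] → [ b ] ≋ [ a ]
  singleton-relation {a} {b} a∙ε∼b∙ε = prep (∼-sym a∼b) ↭-refl
    where
    a∼b : proj₁ a ∼ proj₁ b
    a∼b = ∼-trans (≈⇒∼ (sym (identityʳ _))) (∼-trans a∙ε∼b∙ε (≈⇒∼ (identityʳ _)))

  cancel-atom : ∀ u x y → InM (u ∷ x) (u ∷ y) → InM x y
  cancel-atom u x y = cancel-∼ cancel (proj₁ u) (π x) (π y)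

  common-atom : ∀ {x y} u d → IsAtomM x y → (u ∷ d) ∣Z x → (u ∷ d) ∣Z y →
                x ≋ [ u ] × y ≋ [ u ]
  common-atom {x} {y} u d (x∼y , _ , indecomposable) (z₁ , x≋udz₁) (z₂ , y≋udz₂) =
    conclude (indecomposable [ u ] [ u ] (d ++ z₁) (d ++ z₂)
                ∼-refl rest-relation x≋udz₁ y≋udz₂)
    where
    rest-relation : InM (d ++ z₁) (d ++ z₂)
    rest-relation = cancel-atom u (d ++ z₁) (d ++ z₂)
      (∼-trans (∼-sym (π-resp-≋ x≋udz₁)) (∼-trans x∼y (π-resp-≋ y≋udz₂)))
    -- (u, u) is not a unit, so the cofactor must be the unit ([], []).
    conclude : IsUnitM [ u ] [ u ] ⊎ IsUnitM (d ++ z₁) (d ++ z₂) → x ≋ [ u ] × y ≋ [ u ]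
    conclude (inj₁ uu-unit) with () ← proj₁ (unitM-trivial uu-unit)
    conclude (inj₂ rest-unit) with unitM-trivial rest-unit
    ... | rest₁≡[] , rest₂≡[] =
      P.subst (λ r → x ≋ (u ∷ r)) rest₁≡[] x≋udz₁ ,
      P.subst (λ r → y ≋ (u ∷ r)) rest₂≡[] y≋udz₂

  gcd-one : ∀ {x y} → IsAtomM x y → ¬ (length x ≡ 1 × length y ≡ 1) → GcdOne x y
  gcd-one _    _         []      _   _   = ↭-refl
  gcd-one atom not-single (u ∷ d) d∣x d∣y with common-atom u d atom d∣x d∣y
  ... | x≋u , y≋u = ⊥-elim (not-single (xs↭ys⇒|xs|≡|ys| x≋u , xs↭ys⇒|xs|≡|ys| y≋u))

lemma4p3 : {c ℓ : Level} (H : CommutativeMonoid c ℓ) →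
    let open MonoidTheory H in
    Cancellative → Atomic →
    ∀ x y → IsAtomM x y →
    (∃[ u ] (x ≋ [ u ] × y ≋ [ u ])) ⊎ GcdOne x y
-- Either both factorizations are single atoms, or the gcd is 1.
lemma4p3 H cancel _ x y atom =
  Sum.map single-atoms (gcd-one atom) (singletons-or-not x y)
  where
  open MonoidTheory H
  open Relations H cancel
  open Permutation (Associates.atomSetoid H) using (↭-refl)
  single-atoms : (∃[ a ] ∃[ b ] (x ≡ [ a ] × y ≡ [ b ])) →
                 ∃[ u ] (x ≋ [ u ] × y ≋ [ u ])
  single-atoms (a , b , P.refl , P.refl) = a , ↭-refl , singleton-relation (proj₁ atom)
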